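{- Let $G=(V,E)$ be a finite simple undirected graph and $C_1,\ldots,C_k\subseteq V$ be communities such that each $(C_i,E(C_i))$ is connected. Consider the greedy algorithm: set $S\leftarrow E$, $A\leftarrow E$; while $A\neq\emptyset$, pick $e\in\arg\max_{e\in A}\mathit{tri}(S\setminus\{e\})$; if every $(C_i,(S\setminus\{e\})(C_i))$ is connected, set $S\leftarrow S\setminus\{e\}$; in any case set $A\leftarrow A\setminus\{e\}$; finally return $S$. The returned $S$ is feasible for \textsc{MaxTri} (every $(C_i,S(C_i))$ is connected) and satisfies $\mathit{tri}(S)\ge \frac{1}{k+1}\,\mathit{tri}(S^*)$, where $S^*$ is an optimal solution of \textsc{MaxTri}. Moreover, if the communities are edge-disjoint ($E(C_i)\cap E(C_j)=\emptyset$ for $i\ne j$), then $\mathit{tri}(S)\ge \frac12\,\mathit{tri}(S^*)$.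
   Context: For $X\subseteq V$ and $F\subseteq E$, $F(X)=\{(u,v)\in F: u,v\in X\}$. An open triangle of $G$ is a wedge $u$–$v$–$w$ of distinct vertices with $(u,v),(v,w)\in E$ and $(u,w)\notin E$ (counted once, unordered in $u,w$); $T$ is the number of open triangles of $G$. For $S\subseteq E$ (strong edges), an STC violation is an open triangle $u$–$v$–$w$ with $(u,v),(v,w)\in S$; $\mathit{viol}(S)$ is their number and $\mathit{tri}(S)=T-\mathit{viol}(S)$. The \textsc{MaxTri} problem: find $S\subseteq E$ such that each $(C_i,S(C_i))$ is connected and $\mathit{tri}(S)$ is maximized. -}

module Defs where

open import Data.Nat using (ℕ; zero; suc; _+_; _*_; _∸_; _≤_; _<_)
open import Data.Nat.Properties using (_<?_)
open import Data.Bool using (Bool; true; false; _∧_; _∨_; not; if_then_else_)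
open import Data.Fin using (Fin; toℕ; _≟_)
open import Data.List using (List; map; allFin)
open import Data.Nat.ListAction using (sum)
open import Data.Product using (_×_)
open import Relation.Nullary using (¬_; ⌊_⌋)
open import Relation.Binary.PropositionalEquality using (_≡_; _≢_)
open import Data.Empty using (⊥)

record Graph (n : ℕ) : Set where
  field
    adj    : Fin n → Fin n → Bool
    sym    : ∀ x y → adj x y ≡ adj y x
    irrefl : ∀ x → adj x x ≡ false
open Graph public

EdgeSet : ℕ → Set
EdgeSet n = Fin n → Fin n → Bool

VertexSet : ℕ → Set
VertexSet n = Fin n → Bool

IsEdgeSubset : ∀ {n} → Graph n → EdgeSet n → Set
IsEdgeSubset G S = (∀ x y → S x y ≡ true → adj G x y ≡ true) × (∀ x y → S x y ≡ S y x)

remove : ∀ {n} → EdgeSet n → Fin n → Fin n → EdgeSet n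
remove S u v x y =
  S x y ∧ not ((⌊ x ≟ u ⌋ ∧ ⌊ y ≟ v ⌋) ∨ (⌊ x ≟ v ⌋ ∧ ⌊ y ≟ u ⌋))

count : ∀ {n} → (Fin n → Bool) → ℕ
count {n} p = sum (map (λ i → if p i then 1 else 0) (allFin n))

-- Number of wedges u–v–w with u < w (each unordered {u,w} once) that are
-- open triangles of G and satisfy the extra predicate q.
countWedges : ∀ {n} → Graph n → (Fin n → Fin n → Fin n → Bool) → ℕ
countWedges {n} G q =
  sum (map (λ u → sum (map (λ v → count (λ w →
      ⌊ toℕ u <? toℕ w ⌋ ∧ adj G u v ∧ adj G v w ∧ not (adj G u w) ∧ q u v w))
      (allFin n))) (allFin n))

openTriangles : ∀ {n} → Graph n → ℕ
openTriangles G = countWedges G (λ _ _ _ → true)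

viol : ∀ {n} → Graph n → EdgeSet n → ℕ
viol G S = countWedges G (λ u v w → S u v ∧ S v w)

tri : ∀ {n} → Graph n → EdgeSet n → ℕ
tri G S = openTriangles G ∸ viol G S

data Reach {n} (C : VertexSet n) (S : EdgeSet n) : Fin n → Fin n → Set where
  here : ∀ {x} → Reach C S x x
  step : ∀ {x y z} → S x y ≡ true → C y ≡ true → Reach C S y z → Reach C S x z

ConnectedIn : ∀ {n} → VertexSet n → EdgeSet n → Set
ConnectedIn C S = ∀ x y → C x ≡ true → C y ≡ true → Reach C S x y

Feasible : ∀ {n k} → (Fin k → VertexSet n) → EdgeSet n → Set
Feasible Cs S = ∀ i → ConnectedIn (Cs i) S

IsOptimal : ∀ {n k} → Graph n → (Fin k → VertexSet n) → EdgeSet n → Set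
IsOptimal G Cs S = IsEdgeSubset G S × Feasible Cs S ×
  (∀ S' → IsEdgeSubset G S' → Feasible Cs S' → tri G S' ≤ tri G S)

EdgeDisjoint : ∀ {n k} → Graph n → (Fin k → VertexSet n) → Set
EdgeDisjoint G Cs = ∀ i j → i ≢ j → ∀ x y → adj G x y ≡ true →
  Cs i x ≡ true → Cs i y ≡ true → Cs j x ≡ true → Cs j y ≡ true → ⊥

-- Greedy G Cs S A S' : the greedy loop, started in state (S, A), can
-- terminate returning S' (any tie-breaking in the argmax is allowed).
data Greedy {n k} (G : Graph n) (Cs : Fin k → VertexSet n)
     : EdgeSet n → EdgeSet n → EdgeSet n → Set where
  done : ∀ {S A} → (∀ x y → A x y ≡ false) → Greedy G Cs S A S
  drop : ∀ {S A R} u v → A u v ≡ true →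
         (∀ x y → A x y ≡ true → tri G (remove S x y) ≤ tri G (remove S u v)) →
         Feasible Cs (remove S u v) →
         Greedy G Cs (remove S u v) (remove A u v) R → Greedy G Cs S A R
  keep : ∀ {S A R} u v → A u v ≡ true →
         (∀ x y → A x y ≡ true → tri G (remove S x y) ≤ tri G (remove S u v)) →
         ¬ Feasible Cs (remove S u v) →
         Greedy G Cs S (remove A u v) R → Greedy G Cs S A R

module Submission where

-- Write V = viol and assume every edge of G lies inside at most m of the
-- communities (m = k always; m = 1 for edge-disjoint communities).  The
-- heart of the proof is an invariant of the greedy loop in state (S, A)
-- that eventually returns F: for every symmetric O ⊆ A such that S ∖ O is
-- feasible,
--            (m + 1) · V F  ≤  V (S ∖ O) + m · V S .  If the chosen edge uv is kept, O
-- cannot contain uv.  If uv is dropped we construct O' ⊆ A ∖ uv for the new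
-- state: either O' = O ∖ uv, or, when uv ∉ O, we repair each community
-- containing uv by giving back one edge ab of O (exchange lemma).  Each
-- repair costs at most V S − V (S ∖ uv), because greedy preferred uv to ab
-- and V satisfies a supermodular exchange inequality on wedges.
-- Starting with S = A = E and O = E ∖ S*, and translating V into
-- tri = T − V, gives tri S* ≤ (m + 1) · tri F.

open import Defs hiding (sym)
open import Data.Nat using (ℕ; zero; suc; _+_; _*_; _∸_; _≤_; _≤ᵇ_; z≤n)
open import Data.Nat.Properties hiding (_≟_)
open import Data.Nat.ListAction using (sum)
open import Algebra.Properties.CommutativeSemigroup +-commutativeSemigroup using (interchange)
open import Data.Nat.Tactic.RingSolver using (solve-∀)
open import Data.Bool using (Bool; true; false; _∧_; _∨_; not; if_then_else_; T)
open import Data.Bool.Properties using (∧-comm; ∨-comm; ∧-zeroʳ; not-involutive; T-∧) renaming (_≟_ to _≟ᵇ_)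
open import Data.Fin using (Fin; toℕ; _≟_)
import Data.Fin.Properties as Fin
open import Data.List using (List; []; _∷_; map; length; allFin)
open import Data.List.Properties using (length-tabulate)
open import Data.List.Membership.Propositional using (_∈_)
open import Data.List.Membership.Propositional.Properties using (∈-allFin)
open import Data.List.Relation.Unary.Any using (here; there)
open import Data.Vec using (Vec; []; _∷_)
open import Data.Product using (_×_; _,_; Σ-syntax; proj₁; proj₂)
import Data.Product as Product
open import Data.Sum using (_⊎_; inj₁; inj₂)
import Data.Sum as Sum
open import Data.Empty using (⊥; ⊥-elim)
open import Data.Unit using (tt)
open import Function using (_∘_; Equivalence)
open import Relation.Nullary using (Dec; yes; no; ⌊_⌋; ¬_; contradiction)
open import Relation.Nullary.Decidable using (_×-dec_)
open import Relation.Binary.PropositionalEquality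
  using (_≡_; refl; sym; trans; cong; cong₂; subst; subst₂)

everyRow : ∀ n → (Vec Bool n → Bool) → Bool
everyRow zero    f = f []
everyRow (suc n) f = everyRow n (f ∘ (true ∷_)) ∧ everyRow n (f ∘ (false ∷_))

everyRow-sound : ∀ n f → T (everyRow n f) → ∀ row → T (f row)
everyRow-sound zero    f ok []            = ok
everyRow-sound (suc n) f ok (true ∷ row)  =
  everyRow-sound n _ (proj₁ (Equivalence.to T-∧ ok)) row
everyRow-sound (suc n) f ok (false ∷ row) =
  everyRow-sound n _ (proj₂ (Equivalence.to T-∧ ok)) row

∧-true⁻ : ∀ {a b} → a ∧ b ≡ true → a ≡ true × b ≡ true
∧-true⁻ {true} b≡true = refl , b≡true

∨-true⁻ : ∀ {a b} → a ∨ b ≡ true → a ≡ true ⊎ b ≡ true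
∨-true⁻ {true}  _       = inj₁ refl
∨-true⁻ {false} b≡true = inj₂ b≡true

decided : ∀ {P : Set} (d : Dec P) → ⌊ d ⌋ ≡ true → P
decided (yes p) _ = p

true≢false : ∀ {b} → b ≡ true → b ≡ false → ⊥
true≢false refl ()

_⊆ₑ_ : ∀ {n} → EdgeSet n → EdgeSet n → Set
X ⊆ₑ Y = ∀ x y → X x y ≡ true → Y x y ≡ true

Symmetric : ∀ {n} → EdgeSet n → Set
Symmetric X = ∀ x y → X x y ≡ X y x

_∖_ : ∀ {n} → EdgeSet n → EdgeSet n → EdgeSet n
(X ∖ O) x y = X x y ∧ not (O x y)

⊆ₑ-trans : ∀ {n} {X Y Z : EdgeSet n} → X ⊆ₑ Y → Y ⊆ₑ Z → X ⊆ₑ Z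
⊆ₑ-trans X⊆Y Y⊆Z x y = Y⊆Z x y ∘ X⊆Y x y

∖-⊆ : ∀ {n} (X O : EdgeSet n) → (X ∖ O) ⊆ₑ X
∖-⊆ X O x y = proj₁ ∘ ∧-true⁻

∖-sym : ∀ {n} {X O : EdgeSet n} → Symmetric X → Symmetric O → Symmetric (X ∖ O)
∖-sym symX symO x y = cong₂ _∧_ (symX x y) (cong not (symO x y))

∖-member : ∀ {n} {X O : EdgeSet n} {x y} → X x y ≡ true → O x y ≡ false → (X ∖ O) x y ≡ true
∖-member Xxy Oxy rewrite Xxy | Oxy = refl

∖-member⁻ : ∀ {n} (X O : EdgeSet n) {x y} → (X ∖ O) x y ≡ true → X x y ≡ true × O x y ≡ false
∖-member⁻ X O {x} {y} e with O x y
... | false = proj₁ (∧-true⁻ e) , refl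
... | true  with () ← proj₂ (∧-true⁻ {X x y} e)

⊆ₑ-false : ∀ {n} {O' O : EdgeSet n} → O' ⊆ₑ O → ∀ {x y} → O x y ≡ false → O' x y ≡ false
⊆ₑ-false {O' = O'} O'⊆O {x} {y} Oxy with O' x y in O'xy
... | false = refl
... | true  = ⊥-elim (true≢false (O'⊆O x y O'xy) Oxy)

∖-antitone : ∀ {n} (X : EdgeSet n) {O O' : EdgeSet n} → O' ⊆ₑ O → (X ∖ O) ⊆ₑ (X ∖ O')
∖-antitone X {O} {O'} O'⊆O x y e with ∖-member⁻ X O e
... | Xxy , Oxy = ∖-member {X = X} {O = O'} Xxy (⊆ₑ-false O'⊆O Oxy)

∖-swap : ∀ {n} (X P Q : EdgeSet n) → ((X ∖ P) ∖ Q) ⊆ₑ ((X ∖ Q) ∖ P)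
∖-swap X P Q x y e with ∖-member⁻ (X ∖ P) Q e
... | XPxy , Qxy with ∖-member⁻ X P XPxy
...   | Xxy , Pxy = ∖-member {X = X ∖ Q} {O = P} (∖-member {X = X} {O = Q} Xxy Qxy) Pxy

∖-mono : ∀ {n} {X Y : EdgeSet n} (O : EdgeSet n) → X ⊆ₑ Y → (X ∖ O) ⊆ₑ (Y ∖ O)
∖-mono {X = X} {Y} O X⊆Y x y e with ∖-member⁻ X O e
... | Xxy , Oxy = ∖-member {X = Y} {O = O} (X⊆Y x y Xxy) Oxy

restore-⊆ : ∀ {n} (X O P : EdgeSet n) → ((X ∖ P) ∖ (O ∖ P)) ⊆ₑ (X ∖ O)
restore-⊆ X O P x y e with X x y | O x y | P x y | e
... | false | _     | _     | ()
... | true  | _     | true  | ()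
... | true  | true  | false | ()
... | true  | false | false | _ = refl

restore-⊇ : ∀ {n} (X O P : EdgeSet n) → P ⊆ₑ O → (X ∖ O) ⊆ₑ ((X ∖ P) ∖ (O ∖ P))
restore-⊇ X O P P⊆O x y e with ∖-member⁻ X O e
... | Xxy , Oxy rewrite Xxy | Oxy | ⊆ₑ-false P⊆O Oxy = refl

-- isEdge u v is the single unordered edge {u,v}; Defs.remove S u v is,
-- by definition, S ∖ isEdge u v.
isEdge : ∀ {n} → Fin n → Fin n → EdgeSet n
isEdge u v x y = (⌊ x ≟ u ⌋ ∧ ⌊ y ≟ v ⌋) ∨ (⌊ x ≟ v ⌋ ∧ ⌊ y ≟ u ⌋)

isEdge-sound : ∀ {n} (u v x y : Fin n) → isEdge u v x y ≡ true →
  (x ≡ u × y ≡ v) ⊎ (x ≡ v × y ≡ u)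
isEdge-sound u v x y = Sum.map (both (x ≟ u) (y ≟ v)) (both (x ≟ v) (y ≟ u)) ∘ ∨-true⁻
  where
  both : ∀ {P Q : Set} (p : Dec P) (q : Dec Q) → ⌊ p ⌋ ∧ ⌊ q ⌋ ≡ true → P × Q
  both p q = Product.map (decided p) (decided q) ∘ ∧-true⁻

isEdge-sym : ∀ {n} (u v : Fin n) → Symmetric (isEdge u v)
isEdge-sym u v x y =
  trans (∨-comm (⌊ x ≟ u ⌋ ∧ ⌊ y ≟ v ⌋) _)
        (cong₂ _∨_ (∧-comm ⌊ x ≟ v ⌋ ⌊ y ≟ u ⌋) (∧-comm ⌊ x ≟ u ⌋ ⌊ y ≟ v ⌋))

decided-refl : ∀ {n} (x : Fin n) → ⌊ x ≟ x ⌋ ≡ true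
decided-refl x with x ≟ x
... | yes _    = refl
... | no  x≢x = contradiction refl x≢x

isEdge-self : ∀ {n} (u v : Fin n) → isEdge u v u v ≡ true
isEdge-self u v rewrite decided-refl u | decided-refl v = refl

isEdge-⊆ : ∀ {n} {O : EdgeSet n} {u v} → Symmetric O → O u v ≡ true → isEdge u v ⊆ₑ O
isEdge-⊆ {u = u} {v} symO Ouv x y e with isEdge-sound u v x y e
... | inj₁ (refl , refl) = Ouv
... | inj₂ (refl , refl) = trans (symO x y) Ouv

remove-sym : ∀ {n} {S : EdgeSet n} u v → Symmetric S → Symmetric (remove S u v)
remove-sym u v symS = ∖-sym symS (isEdge-sym u v)

remove-self : ∀ {n} (S : EdgeSet n) u v → remove S u v u v ≡ false
remove-self S u v rewrite isEdge-self u v = ∧-zeroʳ (S u v)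

remove-lost : ∀ {n} (S : EdgeSet n) u v {x y} → S x y ≡ true → remove S u v x y ≡ false →
  isEdge u v x y ≡ true
remove-lost S u v {x} {y} Sxy lost with isEdge u v x y
... | true  = refl
... | false with () ← trans (sym lost) (cong (_∧ true) Sxy)

⊆-remove : ∀ {n} {O A : EdgeSet n} {u v} → Symmetric O → O u v ≡ false → O ⊆ₑ A →
  O ⊆ₑ remove A u v
⊆-remove {O = O} {A} {u} {v} symO Ouv O⊆A x y Oxy =
  ∖-member {X = A} {O = isEdge u v} (O⊆A x y Oxy) avoids
  where
  avoids : isEdge u v x y ≡ false
  avoids with isEdge u v x y in e
  ... | false = refl
  ... | true with isEdge-sound u v x y e
  ...   | inj₁ (refl , refl) = ⊥-elim (true≢false Oxy Ouv)
  ...   | inj₂ (refl , refl) = ⊥-elim (true≢false (trans (symO u v) Oxy) Ouv)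

module Paths {n : ℕ} (C : VertexSet n) where

  reach-mono : ∀ {X Y : EdgeSet n} → X ⊆ₑ Y → ∀ {x y} → Reach C X x y → Reach C Y x y
  reach-mono X⊆Y here           = here
  reach-mono X⊆Y (step e c r)  = step (X⊆Y _ _ e) c (reach-mono X⊆Y r)

  reach-trans : ∀ {X : EdgeSet n} {x y z} → Reach C X x y → Reach C X y z → Reach C X x z
  reach-trans here          r' = r'
  reach-trans (step e c r)  r' = step e c (reach-trans r r')

  reach-sym : ∀ {X : EdgeSet n} → Symmetric X → ∀ {x y} → C x ≡ true → Reach C X x y → Reach C X y x
  reach-sym symX cx here = here
  reach-sym symX {x} cx (step {y = y} e cy r) =
    reach-trans (reach-sym symX cy r) (step (trans (symX y x) e) cx here)

  connected-mono : ∀ {X Y : EdgeSet n} → X ⊆ₑ Y → ConnectedIn C X → ConnectedIn C Y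
  connected-mono X⊆Y conn x y cx cy = reach-mono X⊆Y (conn x y cx cy)

  reach-inside : ∀ {X Y : EdgeSet n} →
    (∀ a b → X a b ≡ true → C a ≡ true → C b ≡ true → Y a b ≡ true) →
    ∀ {x z} → C x ≡ true → Reach C X x z → Reach C Y x z
  reach-inside X⊆Y cx here         = here
  reach-inside X⊆Y cx (step e c r) = step (X⊆Y _ _ e cx c) c (reach-inside X⊆Y c r)

  isEdge-inside : ∀ {u v a b} → isEdge u v a b ≡ true → C a ≡ true → C b ≡ true →
    C u ≡ true × C v ≡ true
  isEdge-inside {u} {v} {a} {b} e ca cb with isEdge-sound u v a b e
  ... | inj₁ (refl , refl) = ca , cb
  ... | inj₂ (refl , refl) = cb , ca

  remove-outside : ∀ {X : EdgeSet n} {u v} → ¬ (C u ≡ true × C v ≡ true) →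
    ConnectedIn C X → ConnectedIn C (remove X u v)
  remove-outside {X} {u} {v} outside conn x z cx cz = reach-inside kept cx (conn x z cx cz)
    where
    kept : ∀ a b → X a b ≡ true → C a ≡ true → C b ≡ true → remove X u v a b ≡ true
    kept a b Xab ca cb with isEdge u v a b in e
    ... | false rewrite Xab = refl
    ... | true  = ⊥-elim (outside (isEdge-inside e ca cb))

  reach-toward : ∀ {S : EdgeSet n} {u} v {x} → Reach C S x u →
    Reach C (remove S u v) x u ⊎ Reach C (remove S u v) x v
  reach-toward v here = inj₁ here
  reach-toward {S} {u} v (step {x = x} {y = y} e cy r) with remove S u v x y in kept
  ... | true  = Sum.map (step kept cy) (step kept cy) (reach-toward v r)
  ... | false with isEdge-sound u v x y (remove-lost S u v e kept)
  ...   | inj₁ (refl , _) = inj₁ here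
  ...   | inj₂ (refl , _) = inj₂ here

  connected-via : ∀ {H : EdgeSet n} {u v} → Symmetric H → C u ≡ true →
    (∀ x → C x ≡ true → Reach C H x u ⊎ Reach C H x v) → Reach C H u v → ConnectedIn C H
  connected-via {H} {u} symH cu side u↝v x z cx cz =
    reach-trans (toU x cx) (reach-sym symH cz (toU z cz))
    where
    toU : ∀ x → C x ≡ true → Reach C H x u
    toU x cx with side x cx
    ... | inj₁ x↝u = x↝u
    ... | inj₂ x↝v = reach-trans x↝v (reach-sym symH cu u↝v)

  record Crossing (S H : EdgeSet n) (u v : Fin n) : Set where
    constructor crossing
    field
      a b  : Fin n
      edge : S a b ≡ true
      a∈C  : C a ≡ true
      b∈C  : C b ≡ true
      a↝u  : Reach C H a u
      b↝v  : Reach C H b v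

  find-crossing : ∀ {S H : EdgeSet n} {u v w} → Symmetric H →
    (∀ x → C x ≡ true → Reach C H x u ⊎ Reach C H x v) →
    C w ≡ true → Reach C H w u → Reach C S w v → Reach C H u v ⊎ Crossing S H u v
  find-crossing symH side cw w↝u here = inj₁ (reach-sym symH cw w↝u)
  find-crossing symH side cw w↝u (step {y = y} e cy r) with side y cy
  ... | inj₁ y↝u = find-crossing symH side cy y↝u r
  ... | inj₂ y↝v = inj₂ (crossing _ y e cw cy w↝u y↝v)

  Exchange : EdgeSet n → EdgeSet n → Fin n → Fin n → Set
  Exchange S O u v =
    ConnectedIn C (remove S u v ∖ O) ⊎
    Σ[ a ∈ Fin n ] Σ[ b ∈ Fin n ] O a b ≡ true × ConnectedIn C (remove S u v ∖ remove O a b)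

  -- Every vertex reaches u or v
  -- in H = (S ∖ {u,v}) ∖ O, and a path from u to v in S ∖ {u,v} either stays
  -- on the u-side or crosses to the v-side along some edge ab; only if
  -- ab ∈ O must it be given back.
  module ExchangeInside {S O : EdgeSet n} {u v : Fin n} (symS : Symmetric S) (symO : Symmetric O)
    (cu : C u ≡ true) (connSO : ConnectedIn C (S ∖ O)) where

    S' : EdgeSet n
    S' = remove S u v

    symS' : Symmetric S'
    symS' = remove-sym u v symS

    side : ∀ x → C x ≡ true → Reach C (S' ∖ O) x u ⊎ Reach C (S' ∖ O) x v
    side x cx = Sum.map (reach-mono swap) (reach-mono swap) (reach-toward v (connSO x u cx cu))
      where
      swap : remove (S ∖ O) u v ⊆ₑ (S' ∖ O)
      swap = ∖-swap S O (isEdge u v)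

    reconnect : ∀ {O'} → O' ⊆ₑ O → Symmetric O' → (cr : Crossing S' (S' ∖ O) u v) →
      (S' ∖ O') (Crossing.a cr) (Crossing.b cr) ≡ true → ConnectedIn C (S' ∖ O')
    reconnect {O'} O'⊆O symO' (crossing a b _ a∈C b∈C a↝u b↝v) ab∈ =
      connected-via symH' cu side'
        (reach-trans (reach-sym symH' a∈C (reach-mono fewer a↝u)) (step ab∈ b∈C (reach-mono fewer b↝v)))
      where
      symH' : Symmetric (S' ∖ O')
      symH' = ∖-sym symS' symO'
      fewer : (S' ∖ O) ⊆ₑ (S' ∖ O')
      fewer = ∖-antitone S' O'⊆O
      side' : ∀ x → C x ≡ true → Reach C (S' ∖ O') x u ⊎ Reach C (S' ∖ O') x v
      side' x cx = Sum.map (reach-mono fewer) (reach-mono fewer) (side x cx)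

    exchange-at : Crossing S' (S' ∖ O) u v → Exchange S O u v
    exchange-at cr@(crossing a b edge _ _ _ _) with O a b in Oab
    ... | false = inj₁ (reconnect (λ _ _ e → e) symO cr (∖-member {X = S'} {O = O} edge Oab))
    ... | true  = inj₂ (a , b , Oab , reconnect (∖-⊆ O (isEdge a b)) (remove-sym a b symO) cr
                         (∖-member {X = S'} {O = remove O a b} edge (remove-self O a b)))

    exchange-inside : C v ≡ true → ConnectedIn C S' → Exchange S O u v
    exchange-inside cv connS' with find-crossing (∖-sym symS' symO) side cu here (connS' u v cu cv)
    ... | inj₁ u↝v = inj₁ (connected-via (∖-sym symS' symO) cu side u↝v)
    ... | inj₂ cr  = exchange-at cr

  exchange : ∀ {S O : EdgeSet n} u v → Symmetric S → Symmetric O →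
    ConnectedIn C (S ∖ O) → ConnectedIn C (remove S u v) → Exchange S O u v
  exchange {S} {O} u v symS symO connSO connS' with (C u ≟ᵇ true) ×-dec (C v ≟ᵇ true)
  ... | yes (cu , cv) = ExchangeInside.exchange-inside {S} {O} {u} {v} symS symO cu connSO cv connS'
  ... | no  outside   = inj₁ (connected-mono (∖-swap S O (isEdge u v)) (remove-outside outside connSO))

ind : Bool → ℕ
ind b = if b then 1 else 0

ind-≤1 : ∀ b → ind b ≤ 1
ind-≤1 true  = ≤-refl
ind-≤1 false = z≤n

sum-quad : ∀ {X : Set} (f g h k : X → ℕ) (l : List X) → (∀ x → f x + g x ≤ h x + k x) →
  sum (map f l) + sum (map g l) ≤ sum (map h l) + sum (map k l)
sum-quad f g h k []      _         = z≤n
sum-quad f g h k (x ∷ l) pointwise =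
  subst₂ _≤_ (interchange (f x) (g x) _ _) (interchange (h x) (k x) _ _)
    (+-mono-≤ (pointwise x) (sum-quad f g h k l pointwise))

-- The exchange inequality for one wedge whose two edges have S-membership
-- s₁ s₂, O-membership o₁ o₂, and are (t₁ t₂) the edge ab or not: the wedge
-- survives in S ∖ (O ∖ ab) and in S ∖ ab at most as often as in S ∖ O and in S.
exchange-row : Vec Bool 6 → Bool
exchange-row (s₁ ∷ s₂ ∷ o₁ ∷ o₂ ∷ t₁ ∷ t₂ ∷ []) =
  (ind ((s₁ ∧ not (o₁ ∧ not t₁)) ∧ (s₂ ∧ not (o₂ ∧ not t₂))) + ind ((s₁ ∧ not t₁) ∧ (s₂ ∧ not t₂)))
  ≤ᵇ (ind ((s₁ ∧ not o₁) ∧ (s₂ ∧ not o₂)) + ind (s₁ ∧ s₂))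

-- wedge-exchange holds because exchange-row is true on all 64 rows.
wedge-exchange : ∀ s₁ s₂ o₁ o₂ t₁ t₂ →
  ind ((s₁ ∧ not (o₁ ∧ not t₁)) ∧ (s₂ ∧ not (o₂ ∧ not t₂))) + ind ((s₁ ∧ not t₁) ∧ (s₂ ∧ not t₂))
  ≤ ind ((s₁ ∧ not o₁) ∧ (s₂ ∧ not o₂)) + ind (s₁ ∧ s₂)
wedge-exchange s₁ s₂ o₁ o₂ t₁ t₂ =
  ≤ᵇ⇒≤ _ _ (everyRow-sound 6 exchange-row tt (s₁ ∷ s₂ ∷ o₁ ∷ o₂ ∷ t₁ ∷ t₂ ∷ []))

module Wedges {n : ℕ} (G : Graph n) where

  WedgePredicate : Set
  WedgePredicate = Fin n → Fin n → Fin n → Bool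

  summand-quad : ∀ (q₁ q₂ q₃ q₄ : WedgePredicate) u v w →
    (adj G u v ≡ true → adj G v w ≡ true →
      ind (q₁ u v w) + ind (q₂ u v w) ≤ ind (q₃ u v w) + ind (q₄ u v w)) →
    ind (⌊ toℕ u <? toℕ w ⌋ ∧ adj G u v ∧ adj G v w ∧ not (adj G u w) ∧ q₁ u v w) +
    ind (⌊ toℕ u <? toℕ w ⌋ ∧ adj G u v ∧ adj G v w ∧ not (adj G u w) ∧ q₂ u v w) ≤
    ind (⌊ toℕ u <? toℕ w ⌋ ∧ adj G u v ∧ adj G v w ∧ not (adj G u w) ∧ q₃ u v w) +
    ind (⌊ toℕ u <? toℕ w ⌋ ∧ adj G u v ∧ adj G v w ∧ not (adj G u w) ∧ q₄ u v w)
  summand-quad q₁ q₂ q₃ q₄ u v w atWedge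
    with ⌊ toℕ u <? toℕ w ⌋ | adj G u v | adj G v w | adj G u w
  ... | false | _     | _     | _     = z≤n
  ... | true  | false | _     | _     = z≤n
  ... | true  | true  | false | _     = z≤n
  ... | true  | true  | true  | true  = z≤n
  ... | true  | true  | true  | false = atWedge refl refl

  countWedges-quad : ∀ (q₁ q₂ q₃ q₄ : WedgePredicate) →
    (∀ u v w → adj G u v ≡ true → adj G v w ≡ true →
      ind (q₁ u v w) + ind (q₂ u v w) ≤ ind (q₃ u v w) + ind (q₄ u v w)) →
    countWedges G q₁ + countWedges G q₂ ≤ countWedges G q₃ + countWedges G q₄
  countWedges-quad q₁ q₂ q₃ q₄ atWedges =
    sum-quad _ _ _ _ (allFin n) λ u →
    sum-quad _ _ _ _ (allFin n) λ v →
    sum-quad _ _ _ _ (allFin n) λ w → summand-quad q₁ q₂ q₃ q₄ u v w (atWedges u v w)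

  countWedges-mono : ∀ (q₁ q₂ : WedgePredicate) →
    (∀ u v w → adj G u v ≡ true → adj G v w ≡ true → ind (q₁ u v w) ≤ ind (q₂ u v w)) →
    countWedges G q₁ ≤ countWedges G q₂
  countWedges-mono q₁ q₂ atWedges = +-cancelʳ-≤ (countWedges G q₁) _ _
    (countWedges-quad q₁ q₁ q₂ q₁ λ u v w uv vw → +-monoˡ-≤ (ind (q₁ u v w)) (atWedges u v w uv vw))

  viol-≤-open : ∀ X → viol G X ≤ openTriangles G
  viol-≤-open X = countWedges-mono _ _ λ u v w _ _ → ind-≤1 (X u v ∧ X v w)

  viol-mono : ∀ {X Y} → X ⊆ₑ Y → viol G X ≤ viol G Y
  viol-mono {X} {Y} X⊆Y = countWedges-mono _ _ λ u v w _ _ → both (X⊆Y u v) (X⊆Y v w)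
    where
    both : ∀ {a b c d} → (a ≡ true → c ≡ true) → (b ≡ true → d ≡ true) → ind (a ∧ b) ≤ ind (c ∧ d)
    both {true}  {true}  a⇒c b⇒d rewrite a⇒c refl | b⇒d refl = ≤-refl
    both {true}  {false} _   _   = z≤n
    both {false}         _   _   = z≤n

  viol-cong : ∀ {X Y} → (∀ x y → adj G x y ≡ true → X x y ≡ Y x y) → viol G X ≡ viol G Y
  viol-cong {X} {Y} agree = ≤-antisym (countWedges-mono _ _ λ u v w uv vw → ≤-reflexive (same u v w uv vw))
                                      (countWedges-mono _ _ λ u v w uv vw → ≤-reflexive (sym (same u v w uv vw)))
    where
    same : ∀ u v w → adj G u v ≡ true → adj G v w ≡ true → ind (X u v ∧ X v w) ≡ ind (Y u v ∧ Y v w)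
    same u v w uv vw = cong ind (cong₂ _∧_ (agree u v uv) (agree v w vw))

  -- Since tri = T − viol and viol ≤ T, comparing tri compares viol reversely.
  tri-antitone : ∀ X Y → tri G X ≤ tri G Y → viol G Y ≤ viol G X
  tri-antitone X Y triX≤triY with viol G Y ≤? viol G X
  ... | yes ok = ok
  ... | no  bad = ⊥-elim (<⇒≱ (∸-monoʳ-< (≰⇒> bad) (viol-≤-open Y)) triX≤triY)

  -- Exchange inequality: giving back ab from O gains at most what removing ab loses.
  viol-exchange : ∀ S O a b →
    viol G (S ∖ remove O a b) + viol G (remove S a b) ≤ viol G (S ∖ O) + viol G S
  viol-exchange S O a b = countWedges-quad _ _ _ _ λ u v w _ _ →
    wedge-exchange (S u v) (S v w) (O u v) (O v w) (isEdge a b u v) (isEdge a b v w)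

-- Arithmetic.  An inequality a + b ≤ c + d reads "a − c ≤ d − b"; such
-- difference bounds add up, and scale with the number of summands.
+-chain : ∀ a b c d e f g → a + b ≤ c + d → c + e ≤ f + g → a + (b + e) ≤ f + (d + g)
+-chain a b c d e f g ab≤cd ce≤fg =
  +-cancelˡ-≤ c _ _ (subst₂ _≤_ (regroupˡ a b c e) (regroupʳ c d f g) (+-mono-≤ ab≤cd ce≤fg))
  where
  regroupˡ : ∀ a b c e → (a + b) + (c + e) ≡ c + (a + (b + e))
  regroupˡ = solve-∀
  regroupʳ : ∀ c d f g → (c + d) + (f + g) ≡ c + (f + (d + g))
  regroupʳ = solve-∀

scale-≤ : ∀ {x o s' s l m} → x + l * s' ≤ o + l * s → s' ≤ s → l ≤ m → x + m * s' ≤ o + m * s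
scale-≤ {x} {o} {s'} {s} {l} bound s'≤s l≤m with m≤n⇒∃[o]m+o≡n l≤m
... | d , refl = begin
  x + (l + d) * s'       ≡⟨ cong (x +_) (*-distribʳ-+ s' l d) ⟩
  x + (l * s' + d * s')  ≡⟨ sym (+-assoc x _ _) ⟩
  x + l * s' + d * s'    ≤⟨ +-mono-≤ bound (*-monoʳ-≤ d s'≤s) ⟩
  o + l * s + d * s      ≡⟨ +-assoc o _ _ ⟩
  o + (l * s + d * s)    ≡⟨ cong (o +_) (sym (*-distribʳ-+ s l d)) ⟩
  o + (l + d) * s        ∎
  where open ≤-Reasoning

ratio-from-viol : ∀ m T vF vS vE → vE ≤ T → suc m * vF ≤ vS + m * vE →
  T ∸ vS ≤ suc m * (T ∸ vF)
ratio-from-viol m T vF vS vE vE≤T bound = begin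
  T ∸ vS                      ≡⟨ sym ([m+n]∸[m+o]≡n∸o (m * T) T vS) ⟩
  (m * T + T) ∸ (m * T + vS)  ≡⟨ cong₂ _∸_ (+-comm (m * T) T) (+-comm (m * T) vS) ⟩
  suc m * T ∸ (vS + m * T)    ≤⟨ ∸-monoʳ-≤ (suc m * T) (≤-trans bound (+-monoʳ-≤ vS (*-monoʳ-≤ m vE≤T))) ⟩
  suc m * T ∸ suc m * vF      ≡⟨ sym (*-distribˡ-∸ (suc m) T vF) ⟩
  suc m * (T ∸ vF)            ∎
  where open ≤-Reasoning

EdgeMultiplicity≤ : ∀ {n k} → ℕ → Graph n → (Fin k → VertexSet n) → Set
EdgeMultiplicity≤ {k = k} m G Cs = ∀ u v → adj G u v ≡ true →
  Σ[ L ∈ List (Fin k) ] length L ≤ m × (∀ i → Cs i u ≡ true → Cs i v ≡ true → i ∈ L)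

greedy-feasible : ∀ {n k} {G : Graph n} {Cs : Fin k → VertexSet n} {S A F} →
  Greedy G Cs S A F → Feasible Cs S → Feasible Cs F
greedy-feasible (done _)                 feasS = feasS
greedy-feasible (drop _ _ _ _ feasS' run) _    = greedy-feasible run feasS'
greedy-feasible (keep _ _ _ _ _ run)      feasS = greedy-feasible run feasS

module GreedyAnalysis {n k : ℕ} (G : Graph n) (Cs : Fin k → VertexSet n) (m : ℕ)
  (multiplicity : EdgeMultiplicity≤ m G Cs) where
  open Wedges G

  V : EdgeSet n → ℕ
  V = viol G

  module DropStep {S A O : EdgeSet n} {u v : Fin n}
    (symS : Symmetric S) (symO : Symmetric O) (O⊆A : O ⊆ₑ A)
    (feasSO : Feasible Cs (S ∖ O)) (feasS' : Feasible Cs (remove S u v))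
    (greedy : ∀ x y → A x y ≡ true → V (remove S u v) ≤ V (remove S x y)) where

    S' : EdgeSet n
    S' = remove S u v

    record Repair (L : List (Fin k)) : Set where
      field
        O'       : EdgeSet n
        O'⊆O     : O' ⊆ₑ O
        symO'    : Symmetric O'
        repaired : ∀ i → i ∈ L → ConnectedIn (Cs i) (S' ∖ O')
        cost     : V (S ∖ O') + length L * V S' ≤ V (S ∖ O) + length L * V S

    one-more : ∀ {L : List (Fin k)} {O₁ O₂ : EdgeSet n} → V (S ∖ O₂) + V S' ≤ V (S ∖ O₁) + V S →
      V (S ∖ O₁) + length L * V S' ≤ V (S ∖ O) + length L * V S →
      V (S ∖ O₂) + suc (length L) * V S' ≤ V (S ∖ O) + suc (length L) * V S
    one-more {L} {O₁} {O₂} =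
      +-chain (V (S ∖ O₂)) (V S') (V (S ∖ O₁)) (V S) (length L * V S') (V (S ∖ O)) (length L * V S)

    repair : ∀ L → Repair L
    repair []      = record
      { O' = O ; O'⊆O = λ _ _ e → e ; symO' = symO ; repaired = λ _ () ; cost = ≤-refl }
    repair (i ∷ L) = extend (repair L)
      (Paths.exchange (Cs i) u v symS symO (feasSO i) (feasS' i))
      where
      extend : Repair L → Paths.Exchange (Cs i) S O u v → Repair (i ∷ L)
      extend R (inj₁ connected) = record
        { O' = O' ; O'⊆O = O'⊆O ; symO' = symO'
        ; repaired = λ { j (here refl) → Paths.connected-mono (Cs i) (∖-antitone S' O'⊆O) connected
                       ; j (there j∈L) → repaired j j∈L }
        ; cost = one-more {L} {O'} {O'} (+-monoʳ-≤ _ (viol-mono (∖-⊆ S (isEdge u v)))) cost }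
        where open Repair R
      extend R (inj₂ (a , b , Oab , connected)) = record
        { O' = remove O' a b
        ; O'⊆O = ⊆ₑ-trans (∖-⊆ O' (isEdge a b)) O'⊆O
        ; symO' = remove-sym a b symO'
        ; repaired = λ
            { j (here refl) → Paths.connected-mono (Cs i) (∖-antitone S' (∖-mono (isEdge a b) O'⊆O)) connected
            ; j (there j∈L) → Paths.connected-mono (Cs j) (∖-antitone S' (∖-⊆ O' (isEdge a b))) (repaired j j∈L) }
        ; cost = one-more {L} {O'} {remove O' a b} give-back cost }
        where
        open Repair R
        -- greedy preferred {u,v} to {a,b}, and the exchange inequality
        give-back : V (S ∖ remove O' a b) + V S' ≤ V (S ∖ O') + V S
        give-back = ≤-trans (+-monoʳ-≤ _ (greedy a b (O⊆A a b Oab))) (viol-exchange S O' a b)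

    record Successor : Set where
      field
        O'       : EdgeSet n
        O'⊆A'    : O' ⊆ₑ remove A u v
        symO'    : Symmetric O'
        feasible : Feasible Cs (S' ∖ O')
        cost     : V (S' ∖ O') + m * V S' ≤ V (S ∖ O) + m * V S

    -- If {u,v} ∈ O, take O ∖ {u,v}: then S' ∖ O' is S ∖ O.
    successor-inside : O u v ≡ true → Successor
    successor-inside Ouv = record
      { O'       = remove O u v
      ; O'⊆A'    = ∖-mono (isEdge u v) O⊆A
      ; symO'    = remove-sym u v symO
      ; feasible = λ i → Paths.connected-mono (Cs i) (restore-⊇ S O (isEdge u v) uv⊆O) (feasSO i)
      ; cost     = +-mono-≤ (viol-mono (restore-⊆ S O (isEdge u v)))
                            (*-monoʳ-≤ m (viol-mono (∖-⊆ S (isEdge u v))))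
      }
      where
      uv⊆O : isEdge u v ⊆ₑ O
      uv⊆O = isEdge-⊆ symO Ouv

    -- If {u,v} ∉ O, repair the (at most m) communities containing {u,v};
    -- all other communities are unaffected by the drop.
    successor-outside : adj G u v ≡ true → O u v ≡ false → Successor
    successor-outside Euv Ouv with multiplicity u v Euv
    ... | L , length≤m , inL = record
      { O'       = O'
      ; O'⊆A'    = ⊆-remove symO' (⊆ₑ-false O'⊆O Ouv) (⊆ₑ-trans O'⊆O O⊆A)
      ; symO'    = symO'
      ; feasible = feasible
      ; cost     = ≤-trans (+-monoˡ-≤ _ (viol-mono (∖-mono O' (∖-⊆ S (isEdge u v)))))
                           (scale-≤ {l = length L} cost (viol-mono (∖-⊆ S (isEdge u v))) length≤m)
      }
      where
      open Repair (repair L)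
      feasible : Feasible Cs (S' ∖ O')
      feasible i with (Cs i u ≟ᵇ true) ×-dec (Cs i v ≟ᵇ true)
      ... | yes (cu , cv) = repaired i (inL i cu cv)
      ... | no  outside   = Paths.connected-mono (Cs i)
            (⊆ₑ-trans (∖-swap S O (isEdge u v)) (∖-antitone S' O'⊆O))
            (Paths.remove-outside (Cs i) outside (feasSO i))

    successor : adj G u v ≡ true → Successor
    successor Euv with O u v in Ouv
    ... | true  = successor-inside Ouv
    ... | false = successor-outside Euv Ouv

  invariant : ∀ {S A F} → Greedy G Cs S A F → Symmetric S → A ⊆ₑ adj G →
    ∀ O → Symmetric O → O ⊆ₑ A → Feasible Cs (S ∖ O) → suc m * V F ≤ V (S ∖ O) + m * V S
  invariant {S} (done A-empty) _ _ O _ O⊆A _ =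
    +-monoˡ-≤ (m * V S) (viol-mono λ x y Sxy → ∖-member {X = S} {O = O} Sxy (⊆ₑ-false O⊆A (A-empty x y)))
  invariant {S} {A} (drop u v Auv choice feasS' run) symS A⊆E O symO O⊆A feasSO =
    ≤-trans (invariant run (remove-sym u v symS) (⊆ₑ-trans (∖-⊆ A (isEdge u v)) A⊆E) O' symO' O'⊆A' feasible)
            cost
    where
    greedy : ∀ x y → A x y ≡ true → V (remove S u v) ≤ V (remove S x y)
    greedy x y Axy = tri-antitone (remove S x y) (remove S u v) (choice x y Axy)
    open DropStep.Successor (DropStep.successor symS symO O⊆A feasSO feasS' greedy (A⊆E u v Auv))
  invariant {S} {A} (keep u v Auv _ infeasible run) symS A⊆E O symO O⊆A feasSO =
    invariant run symS (⊆ₑ-trans (∖-⊆ A (isEdge u v)) A⊆E) O symO (⊆-remove symO uv∉O O⊆A) feasSO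
    where
    -- {u,v} could not be dropped, so no feasible S ∖ O omits it.
    uv∉O : O u v ≡ false
    uv∉O with O u v in Ouv
    ... | false = refl
    ... | true  = ⊥-elim (infeasible λ i →
            Paths.connected-mono (Cs i) (∖-antitone S (isEdge-⊆ symO Ouv)) (feasSO i))

  -- Against any feasible S* ⊆ E the greedy output F loses at most a factor
  -- m + 1: apply the invariant to the whole run with O = E ∖ S*.
  greedy-bound : ∀ {F} → Greedy G Cs (adj G) (adj G) F →
    ∀ S* → IsEdgeSubset G S* → Feasible Cs S* → tri G S* ≤ suc m * tri G F
  greedy-bound {F} run S* (S*⊆E , symS*) feasS* =
    ratio-from-viol m (openTriangles G) (V F) (V S*) (V (adj G)) (viol-≤-open (adj G))
      (subst (λ t → suc m * V F ≤ t + m * V (adj G)) (viol-cong same)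
        (invariant run (Graph.sym G) (λ _ _ e → e) O (∖-sym (Graph.sym G) symS*) (∖-⊆ (adj G) S*) feasEO))
    where
    O : EdgeSet n
    O = adj G ∖ S*

    same : ∀ x y → adj G x y ≡ true → (adj G ∖ O) x y ≡ S* x y
    same x y Exy rewrite Exy = not-involutive (S* x y)

    feasEO : Feasible Cs (adj G ∖ O)
    feasEO i = Paths.connected-mono (Cs i) (λ x y S*xy → trans (same x y (S*⊆E x y S*xy)) S*xy) (feasS* i)

multiplicity-all : ∀ {n k} (G : Graph n) (Cs : Fin k → VertexSet n) → EdgeMultiplicity≤ k G Cs
multiplicity-all {k = k} G Cs u v _ =
  allFin k , ≤-reflexive (length-tabulate (λ i → i)) , λ i _ _ → ∈-allFin i

multiplicity-disjoint : ∀ {n k} (G : Graph n) (Cs : Fin k → VertexSet n) →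
  EdgeDisjoint G Cs → EdgeMultiplicity≤ 1 G Cs
multiplicity-disjoint G Cs disjoint u v Euv
  with Fin.any? (λ i → (Cs i u ≟ᵇ true) ×-dec (Cs i v ≟ᵇ true))
... | yes (i , (ciu , civ)) = (i ∷ []) , ≤-refl , only-i
  where
  only-i : ∀ j → Cs j u ≡ true → Cs j v ≡ true → j ∈ i ∷ []
  only-i j cju cjv with j Fin.≟ i
  ... | yes j≡i = here j≡i
  ... | no  j≢i = ⊥-elim (disjoint j i j≢i u v Euv cju cjv ciu civ)
... | no  none = [] , z≤n , λ i ciu civ → ⊥-elim (none (i , (ciu , civ)))

mainTheorem5 : ∀ {n k} (G : Graph n) (Cs : Fin k → VertexSet n) →
    (∀ i → ConnectedIn (Cs i) (adj G)) →
    ∀ S → Greedy G Cs (adj G) (adj G) S →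
    Feasible Cs S ×
    (∀ S* → IsOptimal G Cs S* → tri G S* ≤ suc k * tri G S) ×
    (EdgeDisjoint G Cs → ∀ S* → IsOptimal G Cs S* → tri G S* ≤ 2 * tri G S)
mainTheorem5 {k = k} G Cs connected S run =
  greedy-feasible run connected ,
  (λ S* (S*⊆E , feasS* , _) →
    GreedyAnalysis.greedy-bound G Cs k (multiplicity-all G Cs) run S* S*⊆E feasS*) ,
  (λ disjoint S* (S*⊆E , feasS* , _) →
    GreedyAnalysis.greedy-bound G Cs 1 (multiplicity-disjoint G Cs disjoint) run S* S*⊆E feasS*)
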